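{- Let $v$ be an even positive integer. Then no Mendelsohn triple system of order $v$ has an $\ell$-good sequencing for any integer $\ell \geq v/2$ (with $\ell \ge 3$).
   Context: A cyclic triple $(x,y,z)$ consists of three distinct elements and contains the directed edges $(x,y),(y,z),(z,x)$; the cyclic triples $(x,y,z),(y,z,x),(z,x,y)$ are regarded as the same. A Mendelsohn triple system of order $v$ (MTS$(v)$) is a pair $(X,\mathcal{T})$ where $X$ is a set of $v$ points and $\mathcal{T}$ is a set of cyclic triples of elements of $X$ such that every ordered pair $(a,b)$ of distinct elements of $X$ occurs as a directed edge in exactly one triple of $\mathcal{T}$. A sequencing is a cyclic ordering $D=(i_1\; i_2\;\cdots\; i_v)$ of all points of $X$ (cyclic shifts are regarded as equal). For the total order $i_1<i_2<\cdots<i_v$, write $[x,y,z]\in\mathcal{C}(D)$ iff $x<y<z$ or $y<z<x$ or $z<x<y$ (i.e., starting at $x$ and going around $D$, one meets $y$ before $z$). A cyclic triple $(x,y,z)$ is contained in $D$ if $[x,y,z]\in\mathcal{C}(D)$. For an integer $\ell\ge 3$, $D$ is $\ell$-good if there is no triple $(x,y,z)\in\mathcal{T}$ that is contained in $D$ and such that $\{x,y,z\}$ is a subset of some $\ell$ cyclically consecutive points of $D$. -}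

module Defs where

open import Data.Nat using (ℕ; _+_; _∸_; _<_; _≤_; _≤ᵇ_)
open import Data.Bool using (if_then_else_)
open import Data.Fin using (Fin; toℕ)
open import Data.Fin.Permutation using (Permutation′; _⟨$⟩ʳ_)
open import Data.List using (List; length; lookup)
open import Data.Product using (_×_; _,_; Σ)
open import Data.Sum using (_⊎_)
open import Relation.Binary.PropositionalEquality using (_≡_; _≢_)

-- A cyclic triple (x , y , z) on the point set Fin v, given by a representative.
Triple : ℕ → Set
Triple v = Fin v × Fin v × Fin v

Distinct : ∀ {v} → Triple v → Set
Distinct (x , y , z) = x ≢ y × y ≢ z × z ≢ x

HasEdge : ∀ {v} → Triple v → Fin v → Fin v → Set
HasEdge (x , y , z) a b =
  (a ≡ x × b ≡ y) ⊎ (a ≡ y × b ≡ z) ⊎ (a ≡ z × b ≡ x)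

-- A Mendelsohn triple system of order v on the points Fin v, the set of
-- cyclic triples being listed (one representative per triple) in T.
-- Every ordered pair of distinct points is an edge of exactly one listed
-- triple (listing the same cyclic triple twice is thereby excluded).
IsMTS : (v : ℕ) → List (Triple v) → Set
IsMTS v T =
  ((i : Fin (length T)) → Distinct (lookup T i)) ×
  ((a b : Fin v) → a ≢ b →
     Σ (Fin (length T)) λ i → HasEdge (lookup T i) a b ×
       ((j : Fin (length T)) → HasEdge (lookup T j) a b → j ≡ i))

-- A sequencing D = (i_1 ... i_v) is represented by the permutation sending each
-- point to its position (0-based) in D.
Sequencing : ℕ → Set
Sequencing v = Permutation′ v

pos : ∀ {v} → Sequencing v → Fin v → ℕ
pos D x = toℕ (D ⟨$⟩ʳ x)

InC : ∀ {v} → Sequencing v → Fin v → Fin v → Fin v → Set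
InC D x y z =
  (pos D x < pos D y × pos D y < pos D z) ⊎
  (pos D y < pos D z × pos D z < pos D x) ⊎
  (pos D z < pos D x × pos D x < pos D y)

cdist : ℕ → ℕ → ℕ → ℕ
cdist v s p = if s ≤ᵇ p then p ∸ s else (v + p) ∸ s

InWindow : ∀ {v} → ℕ → Sequencing v → Fin v → Fin v → Fin v → Set
InWindow {v} ℓ D x y z =
  Σ (Fin v) λ s →
    cdist v (toℕ s) (pos D x) < ℓ ×
    cdist v (toℕ s) (pos D y) < ℓ ×
    cdist v (toℕ s) (pos D z) < ℓ

Good : ∀ {v} → ℕ → List (Triple v) → Sequencing v → Set
Good {v} ℓ T D =
  (i : Fin (length T)) → let (x , y , z) = lookup T i in
    InC D x y z → InWindow ℓ D x y z → Data.Empty.⊥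
  where import Data.Empty

-- Write v = 2m, number the positions of the sequencing D by ℕ (read mod v)
-- and let P x be the point at position x.  A triple met by D in its own
-- cyclic order, at positions x, x+a, x+b with 0 < a < b < v, is contained in
-- D; goodness says that no window of ℓ consecutive positions covers it, i.e.
-- its three gaps a, b-a, v-b are all at most B = v - ℓ ≤ m.
module Submission where

open import Data.Bool using (true; false)
open import Data.Empty using (⊥; ⊥-elim)
open import Data.Fin using (Fin; toℕ; fromℕ<)
open import Data.Fin.Permutation using (_⟨$⟩ˡ_; inverseʳ; inverseˡ)
open import Data.Fin.Properties using (toℕ-injective; toℕ-fromℕ<; toℕ<n)
open import Data.List using (List; length; lookup)
open import Data.Nat using (ℕ; zero; suc; _+_; _*_; _∸_; _≤_; _<_; z≤n; s≤s; s≤s⁻¹; _≤ᵇ_; _%_; _≤?_; _<?_; NonZero)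
open import Data.Nat.DivMod using (m%n<n; m<n⇒m%n≡m; %-distribˡ-+; [m+n]%n≡m%n)
open import Data.Nat.Divisibility using (_∣_; divides)
open import Data.Nat.Properties
open import Data.Nat.Tactic.RingSolver using (solve-∀)
open import Data.Product using (Σ; _×_; _,_; proj₁; proj₂)
open import Data.Sum using (_⊎_; inj₁; inj₂)
open import Data.Unit using (tt)
open import Relation.Binary.PropositionalEquality
open import Relation.Nullary using (¬_; yes; no)
open import Relation.Nullary.Decidable using (from-yes)

open import Defs

open import Algebra.Properties.CommutativeSemigroup +-commutativeSemigroup using (xy∙z≈xz∙y)

+-swapʳ : ∀ i a b → i + a + b ≡ i + b + a
+-swapʳ = xy∙z≈xz∙y

+-assoc-comm : ∀ i a b → i + a + b ≡ i + (b + a)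
+-assoc-comm i a b = trans (+-assoc i a b) (cong (i +_) (+-comm a b))

-- i + n + (n + 1) is the position i + 1 shifted by a full period 2n
+-wrap : ∀ i n → i + n + (n + 1) ≡ i + 1 + (n + n)
+-wrap = solve-∀

+-suc-last : ∀ i n → i + n + 1 ≡ i + suc n
+-suc-last = solve-∀

+-wrap-suc : ∀ i n → i + n + (suc n + 1) ≡ i + (suc n + suc n)
+-wrap-suc = solve-∀

+-two : ∀ i n → i + 1 + (n + 1) ≡ i + (n + 2)
+-two = solve-∀

+-three : ∀ i n → i + (n + 2) + 1 ≡ i + (n + 3)
+-three = solve-∀

+-wrap-two : ∀ i n → i + (n + 2) + n ≡ i + 2 + (n + n)
+-wrap-two = solve-∀

1<-of-≢1 : ∀ {e} → 0 < e → (e ≡ 1 → ⊥) → 1 < e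
1<-of-≢1 {suc zero}    _ e≢1 = ⊥-elim (e≢1 refl)
1<-of-≢1 {suc (suc e)} _ _   = s≤s (s≤s z≤n)

between₁ : ∀ {m e} → m ≤ e → e ≤ 1 + m → e ≡ m ⊎ e ≡ m + 1
between₁ {m} m≤e e≤1+m with m≤n⇒m<n∨m≡n m≤e
... | inj₂ m≡e = inj₁ (sym m≡e)
... | inj₁ m<e = inj₂ (trans (≤-antisym e≤1+m m<e) (+-comm 1 m))

between₂ : ∀ {m e} → m ≤ e → e ≤ 2 + m → e ≡ m ⊎ e ≡ m + 1 ⊎ e ≡ m + 2
between₂ {m} m≤e e≤2+m with m≤n⇒m<n∨m≡n m≤e
... | inj₂ m≡e = inj₁ (sym m≡e)
... | inj₁ m<e with between₁ m<e e≤2+m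
...   | inj₁ e≡1+m = inj₂ (inj₁ (trans e≡1+m (+-comm 1 m)))
...   | inj₂ e≡2+m = inj₂ (inj₂ (trans e≡2+m (sym (+-suc m 1))))

-- A cyclic system of half-period m and gap bound B: the points P x at the
-- positions x ∈ ℕ (read modulo 2m), and a family of blocks (the triples),
-- each with a directed edge relation E, such that every edge between two
-- different positions lies in exactly one block, each block is a directed
-- 3-cycle, and a block met in the cyclic order of the positions
-- (x → x+a → x+b → x) has its three gaps a, b - a, 2m - b bounded by B.
record CyclicSystem (m B : ℕ) : Set₁ where
  field
    Point : Set
    P     : ℕ → Point
    Block : Set
    E     : Block → Point → Point → Set
    periodic   : ∀ x → P (x + (m + m)) ≡ P x
    injective  : ∀ x d → 0 < d → d < m + m → P x ≡ P (x + d) → ⊥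
    cover      : ∀ x d → 0 < d → d < m + m → Σ Block λ j → E j (P x) (P (x + d))
    unique     : ∀ {j k a b} → E j a b → E k a b → j ≡ k
    out-unique : ∀ {j a b c} → E j a b → E j a c → b ≡ c
    in-unique  : ∀ {j a b c} → E j a c → E j b c → a ≡ b
    third : ∀ {j} x d → 0 < d → d < m + m → E j (P x) (P (x + d)) →
      Σ ℕ λ e → 0 < e × e < m + m × (e ≡ d → ⊥) ×
        E j (P (x + d)) (P (x + e)) × E j (P (x + e)) (P x)
    gaps : ∀ {j} x a b → 0 < a → a < b → b < m + m →
      E j (P x) (P (x + a)) → E j (P (x + a)) (P (x + b)) → E j (P (x + b)) (P x) →
      a ≤ B × b ≤ a + B × m + m ≤ b + B
    B≤m : B ≤ m

module CyclicFacts {m B : ℕ} (S : CyclicSystem m B) where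
  open CyclicSystem S

  edge-cong : ∀ {j a b c d} → a ≡ c → b ≡ d → E j a b → E j c d
  edge-cong refl refl h = h

  P-mod : ∀ {x y} → x ≡ y + (m + m) → P x ≡ P y
  P-mod {x} {y} x≡y+2m = trans (cong P x≡y+2m) (periodic y)

  distinct : ∀ x {a b} → a < b → b < m + m → P (x + a) ≡ P (x + b) → ⊥
  distinct x {a} {b} a<b b<2m same =
    injective (x + a) (b ∸ a) (m<n⇒0<n∸m a<b) (≤-<-trans (m∸n≤m b a) b<2m)
      (trans same (cong P (trans (cong (x +_) (sym (m+[n∸m]≡n (<⇒≤ a<b))))
                                 (sym (+-assoc x a (b ∸ a))))))

  lowerBound : ∀ {e} → m + m ≤ e + B → m ≤ e
  lowerBound {e} 2m≤e+B = +-cancelʳ-≤ m m e (≤-trans 2m≤e+B (+-monoʳ-≤ e B≤m))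

  unitBlock : 1 < m + m → ∀ i → Σ Block λ j → Σ ℕ λ e →
    E j (P i) (P (i + 1)) × E j (P (i + 1)) (P (i + e)) × E j (P (i + e)) (P i) ×
    e ≤ 1 + B × m + m ≤ e + B
  unitBlock 1<2m i with cover i 1 (s≤s z≤n) 1<2m
  ... | j , h with third i 1 (s≤s z≤n) 1<2m h
  ... | e , 0<e , e<2m , e≢1 , h₁ , h₂
    with gaps i 1 e (s≤s z≤n) (1<-of-≢1 0<e e≢1) e<2m h h₁ h₂
  ... | _ , e≤1+B , 2m≤e+B = j , e , h , h₁ , h₂ , e≤1+B , 2m≤e+B

  -- If B < m, the three gaps of the block through (0, 1) cannot add up to 2m.
  tightBound : B < m → ⊥
  tightBound B<m with unitBlock (+-mono-≤ (≤-trans (s≤s z≤n) B<m) (≤-trans (s≤s z≤n) B<m)) 0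
  ... | _ , e , _ , _ , _ , e≤1+B , 2m≤e+B = <-irrefl refl (begin-strict
    m + m  ≤⟨ 2m≤e+B ⟩
    e + B  ≤⟨ +-monoˡ-≤ B (≤-trans e≤1+B B<m) ⟩
    m + B  <⟨ +-monoʳ-< m B<m ⟩
    m + m  ∎)
    where open ≤-Reasoning

module Regimes (k : ℕ) {B : ℕ} (S : CyclicSystem (3 + k) B) where
  open CyclicSystem S
  open CyclicFacts S

  m : ℕ
  m = 3 + k

  1<m : 1 < m
  1<m = s≤s (s≤s z≤n)

  2<m : 2 < m
  2<m = s≤s (s≤s (s≤s z≤n))

  m<2m : m < m + m
  m<2m = m<m+n m (s≤s z≤n)

  UnitBlock : ℕ → ℕ → Set
  UnitBlock e i = Σ Block λ j →
    E j (P i) (P (i + 1)) × E j (P (i + 1)) (P (i + e)) × E j (P (i + e)) (P i)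

  -- that third point is at i + m ("short") or at i + m + 1 ("long")
  unitShape : ∀ i → UnitBlock m i ⊎ UnitBlock (m + 1) i
  unitShape i with unitBlock (<-trans 1<m m<2m) i
  ... | j , e , h , h₁ , h₂ , e≤1+B , 2m≤e+B with between₁ (lowerBound 2m≤e+B) (≤-trans e≤1+B (s≤s B≤m))
  ...   | inj₁ refl = inj₁ (j , h , h₁ , h₂)
  ...   | inj₂ refl = inj₂ (j , h , h₁ , h₂)

  -- Both shapes would be one block (it contains the edge (i, i+1)) in which
  -- i has the two in-neighbours i+m and i+m+1.
  unitExclusive : ∀ i → UnitBlock m i → UnitBlock (m + 1) i → ⊥
  unitExclusive i (j , h , _ , h₂) (j' , g , _ , g₂) with unique h g
  ... | refl = distinct i (m<m+n m (s≤s z≤n)) (+-monoʳ-< m 1<m) (in-unique h₂ g₂)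

  -- The long shape propagates from i to i + 1.  The block through
  -- (i+m, i+m+1) cannot be short (it would be the long block of i, where i
  -- has out-neighbours i+1 and i+m), so it is long; then the block through
  -- (i+1, i+2) cannot be short (it would be that block, where i+1 has
  -- out-neighbours i+2 and i+m).
  longStep : ∀ i → UnitBlock (m + 1) i → UnitBlock (m + 1) (i + 1)
  longStep i (j , h , h₁ , h₂) with unitShape (i + m)
  ... | inj₁ (_ , _ , a₁ , a₂) with unique (edge-cong (cong P (+-assoc i m 1)) (P-mod (+-assoc i m m)) a₁) h₂
  ...   | refl = ⊥-elim (distinct i 1<m m<2m (out-unique h (edge-cong (P-mod (+-assoc i m m)) refl a₂)))
  longStep i (j , h , h₁ , h₂) | inj₂ (_ , _ , a₁ , a₂) with unitShape (i + 1)
  ... | inj₂ long = long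
  ... | inj₁ (_ , g , _ , g₂) with unique (edge-cong (cong P (+-swapʳ i 1 m)) refl g₂) (edge-cong refl (P-mod (+-wrap i m)) a₁)
  ...   | refl = ⊥-elim (distinct i 2<m m<2m
            (trans (cong P (sym (+-assoc i 1 1))) (out-unique g (edge-cong (P-mod (+-wrap i m)) refl a₂))))

  unitPeriodic : ∀ e x → UnitBlock e (x + (m + m)) → UnitBlock e x
  unitPeriodic e x (j , h , h₁ , h₂) =
    j , edge-cong (periodic x) (shift 1) h , edge-cong (shift 1) (shift e) h₁ ,
        edge-cong (shift e) (periodic x) h₂
    where
      shift : ∀ c → P (x + (m + m) + c) ≡ P (x + c)
      shift c = P-mod (+-swapʳ x (m + m) c)

  longIterate : ∀ i n → UnitBlock (m + 1) i → UnitBlock (m + 1) (i + n)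
  longIterate i zero    long = subst (UnitBlock (m + 1)) (sym (+-identityʳ i)) long
  longIterate i (suc n) long = subst (UnitBlock (m + 1)) (trans (+-comm (i + n) 1) (sym (+-suc i n)))
    (longStep (i + n) (longIterate i n long))

  longAtMultiple : ∀ c → UnitBlock (m + 1) (c * (m + m)) → UnitBlock (m + 1) 0
  longAtMultiple zero    long = long
  longAtMultiple (suc c) long = longAtMultiple c (unitPeriodic (m + 1) (c * (m + m))
    (subst (UnitBlock (m + 1)) (+-comm (m + m) (c * (m + m))) long))

  -- a long block anywhere gives one at 0 (go forward to the next multiple of 2m)
  longReturns : ∀ n → UnitBlock (m + 1) n → UnitBlock (m + 1) 0
  longReturns n long = longAtMultiple n
    (subst (UnitBlock (m + 1)) (m+[n∸m]≡n (m≤m*n n (m + m))) (longIterate n (n * (m + m) ∸ n) long))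

  Regime : Set
  Regime = (∀ i → UnitBlock m i) ⊎ (∀ i → UnitBlock (m + 1) i)

  regime : Regime
  regime with unitShape 0
  ... | inj₂ long₀  = inj₂ λ i → longIterate 0 i long₀
  ... | inj₁ short₀ = inj₁ short
    where
      short : ∀ i → UnitBlock m i
      short i with unitShape i
      ... | inj₁ s    = s
      ... | inj₂ long = ⊥-elim (unitExclusive 0 short₀ (longReturns i long))

  data SkipBlock (i : ℕ) : Set where
    backward : ∀ j → E j (P i) (P (i + 2)) → E j (P (i + 2)) (P (i + 1)) → E j (P (i + 1)) (P i) →
               SkipBlock i
    forward  : ∀ j e → E j (P i) (P (i + 2)) → E j (P (i + 2)) (P (i + e)) → E j (P (i + e)) (P i) →
               e ≡ m ⊎ e ≡ m + 1 ⊎ e ≡ m + 2 → SkipBlock i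

  skipBlock : ∀ i → SkipBlock i
  skipBlock i with cover i 2 (s≤s z≤n) (<-trans 2<m m<2m)
  ... | j , h with third i 2 (s≤s z≤n) (<-trans 2<m m<2m) h
  ... | 0 , () , _
  ... | 1 , _ , _ , _ , h₁ , h₂ = backward j h h₁ h₂
  ... | 2 , _ , _ , e≢2 , _ = ⊥-elim (e≢2 refl)
  ... | e@(suc (suc (suc _))) , _ , e<2m , _ , h₁ , h₂
    with gaps i 2 e (s≤s z≤n) (s≤s (s≤s (s≤s z≤n))) e<2m h h₁ h₂
  ...   | _ , e≤2+B , 2m≤e+B =
    forward j e h h₁ h₂ (between₂ (lowerBound 2m≤e+B) (≤-trans e≤2+B (+-monoʳ-≤ 2 B≤m)))

-- For m ≥ 4 (m = 4 + k) no block through an edge (i, i+2) can be met in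
-- cyclic order: in either regime it shares an edge with a unit block, which
-- forces two different positions to carry the same point.  Hence the blocks
-- through (0, 2) and (1, 3) both run backwards, and they share the edge (2, 1).
module AtLeastFour (k : ℕ) {B : ℕ} (S : CyclicSystem (4 + k) B) where
  open CyclicSystem S
  open CyclicFacts S
  open Regimes (suc k) S

  m₋ : ℕ
  m₋ = 3 + k

  2<m₋ : 2 < m₋
  2<m₋ = s≤s (s≤s (s≤s z≤n))

  3<m : 3 < m
  3<m = s≤s (s≤s (s≤s (s≤s z≤n)))

  noForwardSkip : Regime → ∀ i j e → E j (P i) (P (i + 2)) → E j (P (i + 2)) (P (i + e)) →
    E j (P (i + e)) (P i) → e ≡ m ⊎ e ≡ m + 1 ⊎ e ≡ m + 2 → ⊥
  -- e = m, short: the short block of i contains (i+m, i) and i → i+1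
  noForwardSkip (inj₁ short) i j e w₀ w₁ w₂ (inj₁ refl) with short i
  ... | _ , g , _ , g₂ with unique w₂ g₂
  ...   | refl = distinct i (from-yes (1 <? 2)) (<-trans 2<m m<2m) (out-unique g w₀)
  -- e = m, long: the long block of i+m-1 contains (i+m, i) and i → i+m-1
  noForwardSkip (inj₂ long) i j e w₀ w₁ w₂ (inj₁ refl) with long (i + m₋)
  ... | _ , _ , g₁ , g₂ with unique (edge-cong (cong P (+-suc-last i m₋)) (P-mod (+-wrap-suc i m₋)) g₁) w₂
  ...   | refl = distinct i 2<m₋ (<-trans (n<1+n m₋) m<2m)
                   (out-unique w₀ (edge-cong (P-mod (+-wrap-suc i m₋)) refl g₂))
  -- e = m + 1, long: the long block of i contains (i+m+1, i) and i → i+1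
  noForwardSkip (inj₂ long) i j e w₀ w₁ w₂ (inj₂ (inj₁ refl)) with long i
  ... | _ , g , _ , g₂ with unique w₂ g₂
  ...   | refl = distinct i (from-yes (1 <? 2)) (<-trans 2<m m<2m) (out-unique g w₀)
  -- e = m + 1, short: the short block of i+1 contains (i+2, i+m+1) and i+1 → i+2
  noForwardSkip (inj₁ short) i j e w₀ w₁ w₂ (inj₂ (inj₁ refl)) with short (i + 1)
  ... | _ , g , g₁ , _ with unique (edge-cong (cong P (+-assoc i 1 1)) (cong P (+-assoc-comm i 1 m)) g₁) w₁
  ...   | refl = injective i 1 (s≤s z≤n) (<-trans 1<m m<2m)
                   (in-unique w₀ (edge-cong refl (cong P (+-assoc i 1 1)) g))
  -- e = m + 2, long: the long block of i+1 contains (i+2, i+m+2) and i+1 → i+2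
  noForwardSkip (inj₂ long) i j e w₀ w₁ w₂ (inj₂ (inj₂ refl)) with long (i + 1)
  ... | _ , g , g₁ , _ with unique (edge-cong (cong P (+-assoc i 1 1)) (cong P (+-two i m)) g₁) w₁
  ...   | refl = injective i 1 (s≤s z≤n) (<-trans 1<m m<2m)
                   (in-unique w₀ (edge-cong refl (cong P (+-assoc i 1 1)) g))
  -- e = m + 2, short: the short block of i+m+2 contains (i+2, i+m+2) and i+m+3 → i+2
  noForwardSkip (inj₁ short) i j e w₀ w₁ w₂ (inj₂ (inj₂ refl)) with short (i + (m + 2))
  ... | _ , _ , g₁ , g₂ with unique (edge-cong (P-mod (+-wrap-two i m)) refl g₂) w₁
  ...   | refl = injective i (m + 3) (s≤s z≤n) (+-monoʳ-< m 3<m)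
                   (in-unique w₀ (edge-cong (cong P (+-three i m)) (P-mod (+-wrap-two i m)) g₁))

  impossible : ⊥
  impossible with skipBlock 0 | skipBlock 1
  ... | forward j e h h₁ h₂ c | _ = noForwardSkip regime 0 j e h h₁ h₂ c
  ... | _ | forward j e h h₁ h₂ c = noForwardSkip regime 1 j e h h₁ h₂ c
  ... | backward j _ h₁ h₂ | backward j' g _ g₂ with unique h₁ g₂
  ...   | refl = injective 0 3 (s≤s z≤n) (<-trans 3<m m<2m) (out-unique h₂ g)

-- For m = 3 the block through the edge (1, 6) = (1, 0) has its third point
-- at one of the positions 2, 3, 4, 5; in either regime it shares an edge
-- with a unit block, which forces two positions to carry the same point.
module Three {B : ℕ} (S : CyclicSystem 3 B) where
  open CyclicSystem S
  open CyclicFacts S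
  open Regimes 0 S

  differ : ∀ {a b} → a < b → b < 6 → P a ≡ P b → ⊥
  differ = distinct 0

  noThirdPoint : Regime → ∀ {j} e → E j (P 6) (P (1 + e)) → E j (P (1 + e)) (P 1) → 0 < e → e < 5 → ⊥
  -- third point 2: long block (2, 3, 6) shares (6, 2); out-neighbours 1, 3 of 2
  noThirdPoint (inj₂ long) 1 r₁ r₂ _ _ with long 2
  ... | _ , g , _ , g₂ with unique r₁ g₂
  ...   | refl = differ (from-yes (1 <? 3)) (from-yes (3 <? 6)) (out-unique r₂ g)
  -- third point 2: short block (5, 6, 2) shares (6, 2); out-neighbours 1, 5 of 2
  noThirdPoint (inj₁ short) 1 r₁ r₂ _ _ with short 5
  ... | _ , _ , g₁ , g₂ with unique r₁ (edge-cong refl (periodic 2) g₁)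
  ...   | refl = differ (from-yes (1 <? 5)) (from-yes (5 <? 6)) (out-unique r₂ (edge-cong (periodic 2) refl g₂))
  -- third point 3: long block (5, 6, 3) shares (6, 3); out-neighbours 1, 5 of 3
  noThirdPoint (inj₂ long) 2 r₁ r₂ _ _ with long 5
  ... | _ , _ , g₁ , g₂ with unique r₁ (edge-cong refl (periodic 3) g₁)
  ...   | refl = differ (from-yes (1 <? 5)) (from-yes (5 <? 6)) (out-unique r₂ (edge-cong (periodic 3) refl g₂))
  -- third point 3: short block (3, 4, 6) shares (6, 3); out-neighbours 1, 4 of 3
  noThirdPoint (inj₁ short) 2 r₁ r₂ _ _ with short 3
  ... | _ , g , _ , g₂ with unique r₁ g₂
  ...   | refl = differ (from-yes (1 <? 4)) (from-yes (4 <? 6)) (out-unique r₂ g)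
  -- third point 4: long block (3, 4, 1) shares (4, 1); in-neighbours 3, 6 of 4
  noThirdPoint (inj₂ long) 3 r₁ r₂ _ _ with long 3
  ... | _ , g , g₁ , _ with unique r₂ (edge-cong refl (periodic 1) g₁)
  ...   | refl = injective 3 3 (from-yes (0 <? 3)) (from-yes (3 <? 6)) (sym (in-unique r₁ g))
  -- third point 4: short block (1, 2, 4) shares (4, 1); in-neighbours 2, 6 of 4
  noThirdPoint (inj₁ short) 3 r₁ r₂ _ _ with short 1
  ... | _ , _ , g₁ , g₂ with unique r₂ g₂
  ...   | refl = injective 2 4 (from-yes (0 <? 4)) (from-yes (4 <? 6)) (sym (in-unique r₁ g₁))
  -- third point 5: long block (1, 2, 5) shares (5, 1); in-neighbours 2, 6 of 5
  noThirdPoint (inj₂ long) 4 r₁ r₂ _ _ with long 1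
  ... | _ , _ , g₁ , g₂ with unique r₂ g₂
  ...   | refl = injective 2 4 (from-yes (0 <? 4)) (from-yes (4 <? 6)) (sym (in-unique r₁ g₁))
  -- third point 5: short block (4, 5, 1) shares (5, 1); in-neighbours 4, 6 of 5
  noThirdPoint (inj₁ short) 4 r₁ r₂ _ _ with short 4
  ... | _ , g , g₁ , _ with unique r₂ (edge-cong refl (periodic 1) g₁)
  ...   | refl = injective 4 2 (from-yes (0 <? 2)) (from-yes (2 <? 6)) (sym (in-unique r₁ g))
  noThirdPoint _ (suc (suc (suc (suc (suc _))))) _ _ _ (s≤s (s≤s (s≤s (s≤s (s≤s ())))))

  impossible : ⊥
  impossible with cover 1 5 (s≤s z≤n) (n<1+n 5)
  ... | j , h with third 1 5 (s≤s z≤n) (n<1+n 5) h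
  ...   | e , 0<e , e<6 , e≢5 , r₁ , r₂ = noThirdPoint regime e r₁ r₂ 0<e (≤∧≢⇒< (s≤s⁻¹ e<6) e≢5)

noCyclicSystem : ∀ {m B} → B < m ⊎ 3 ≤ m → CyclicSystem m B → ⊥
noCyclicSystem (inj₁ B<m) S = CyclicFacts.tightBound S B<m
noCyclicSystem {1} (inj₂ (s≤s ())) _
noCyclicSystem {2} (inj₂ (s≤s (s≤s ()))) _
noCyclicSystem {3} (inj₂ _) S = Three.impossible S
noCyclicSystem {suc (suc (suc (suc k)))} (inj₂ _) S = AtLeastFour.impossible k S

module _ {v : ℕ} where

  edge-distinct : ∀ {a b} (t : Triple v) → Distinct t → HasEdge t a b → a ≡ b → ⊥
  edge-distinct _ (x≢y , _ , _) (inj₁ (refl , refl)) = x≢y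
  edge-distinct _ (_ , y≢z , _) (inj₂ (inj₁ (refl , refl))) = y≢z
  edge-distinct _ (_ , _ , z≢x) (inj₂ (inj₂ (refl , refl))) = z≢x

  edge-out-unique : ∀ {a b c} (t : Triple v) → Distinct t → HasEdge t a b → HasEdge t a c → b ≡ c
  edge-out-unique _ _ (inj₁ (refl , refl)) (inj₁ (_ , refl)) = refl
  edge-out-unique _ (x≢y , _ , _) (inj₁ (refl , refl)) (inj₂ (inj₁ (x≡y , _))) = ⊥-elim (x≢y x≡y)
  edge-out-unique _ (_ , _ , z≢x) (inj₁ (refl , refl)) (inj₂ (inj₂ (x≡z , _))) = ⊥-elim (z≢x (sym x≡z))
  edge-out-unique _ (x≢y , _ , _) (inj₂ (inj₁ (refl , refl))) (inj₁ (y≡x , _)) = ⊥-elim (x≢y (sym y≡x))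
  edge-out-unique _ _ (inj₂ (inj₁ (refl , refl))) (inj₂ (inj₁ (_ , refl))) = refl
  edge-out-unique _ (_ , y≢z , _) (inj₂ (inj₁ (refl , refl))) (inj₂ (inj₂ (y≡z , _))) = ⊥-elim (y≢z y≡z)
  edge-out-unique _ (_ , _ , z≢x) (inj₂ (inj₂ (refl , refl))) (inj₁ (z≡x , _)) = ⊥-elim (z≢x z≡x)
  edge-out-unique _ (_ , y≢z , _) (inj₂ (inj₂ (refl , refl))) (inj₂ (inj₁ (z≡y , _))) = ⊥-elim (y≢z (sym z≡y))
  edge-out-unique _ _ (inj₂ (inj₂ (refl , refl))) (inj₂ (inj₂ (_ , refl))) = refl

  edge-in-unique : ∀ {a b c} (t : Triple v) → Distinct t → HasEdge t a c → HasEdge t b c → a ≡ b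
  edge-in-unique _ _ (inj₁ (refl , refl)) (inj₁ (refl , _)) = refl
  edge-in-unique _ (_ , y≢z , _) (inj₁ (refl , refl)) (inj₂ (inj₁ (_ , y≡z))) = ⊥-elim (y≢z y≡z)
  edge-in-unique _ (x≢y , _ , _) (inj₁ (refl , refl)) (inj₂ (inj₂ (_ , y≡x))) = ⊥-elim (x≢y (sym y≡x))
  edge-in-unique _ (_ , y≢z , _) (inj₂ (inj₁ (refl , refl))) (inj₁ (_ , z≡y)) = ⊥-elim (y≢z (sym z≡y))
  edge-in-unique _ _ (inj₂ (inj₁ (refl , refl))) (inj₂ (inj₁ (refl , _))) = refl
  edge-in-unique _ (_ , _ , z≢x) (inj₂ (inj₁ (refl , refl))) (inj₂ (inj₂ (_ , z≡x))) = ⊥-elim (z≢x z≡x)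
  edge-in-unique _ (x≢y , _ , _) (inj₂ (inj₂ (refl , refl))) (inj₁ (_ , x≡y)) = ⊥-elim (x≢y x≡y)
  edge-in-unique _ (_ , _ , z≢x) (inj₂ (inj₂ (refl , refl))) (inj₂ (inj₁ (_ , x≡z))) = ⊥-elim (z≢x (sym x≡z))
  edge-in-unique _ _ (inj₂ (inj₂ (refl , refl))) (inj₂ (inj₂ (refl , _))) = refl

  edge-third : ∀ {a b} (t : Triple v) → Distinct t → HasEdge t a b →
    Σ (Fin v) λ c → HasEdge t b c × HasEdge t c a × (c ≡ a → ⊥) × (c ≡ b → ⊥)
  edge-third (x , y , z) (x≢y , y≢z , z≢x) (inj₁ (refl , refl)) =
    z , inj₂ (inj₁ (refl , refl)) , inj₂ (inj₂ (refl , refl)) , z≢x , λ z≡y → y≢z (sym z≡y)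
  edge-third (x , y , z) (x≢y , y≢z , z≢x) (inj₂ (inj₁ (refl , refl))) =
    x , inj₂ (inj₂ (refl , refl)) , inj₁ (refl , refl) , x≢y , λ x≡z → z≢x (sym x≡z)
  edge-third (x , y , z) (x≢y , y≢z , z≢x) (inj₂ (inj₂ (refl , refl))) =
    y , inj₁ (refl , refl) , inj₂ (inj₁ (refl , refl)) , y≢z , λ y≡x → x≢y (sym y≡x)

  edge-rotation : ∀ {a b c} (t : Triple v) → Distinct t → HasEdge t a b → HasEdge t b c →
    (proj₁ t ≡ a × proj₁ (proj₂ t) ≡ b × proj₂ (proj₂ t) ≡ c) ⊎
    (proj₁ t ≡ b × proj₁ (proj₂ t) ≡ c × proj₂ (proj₂ t) ≡ a) ⊎
    (proj₁ t ≡ c × proj₁ (proj₂ t) ≡ a × proj₂ (proj₂ t) ≡ b)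
  edge-rotation _ (x≢y , _ , _) (inj₁ (refl , refl)) (inj₁ (y≡x , _)) = ⊥-elim (x≢y (sym y≡x))
  edge-rotation _ _ (inj₁ (refl , refl)) (inj₂ (inj₁ (_ , refl))) = inj₁ (refl , refl , refl)
  edge-rotation _ (_ , y≢z , _) (inj₁ (refl , refl)) (inj₂ (inj₂ (y≡z , _))) = ⊥-elim (y≢z y≡z)
  edge-rotation _ (_ , _ , z≢x) (inj₂ (inj₁ (refl , refl))) (inj₁ (z≡x , _)) = ⊥-elim (z≢x z≡x)
  edge-rotation _ (_ , y≢z , _) (inj₂ (inj₁ (refl , refl))) (inj₂ (inj₁ (z≡y , _))) = ⊥-elim (y≢z (sym z≡y))
  edge-rotation _ _ (inj₂ (inj₁ (refl , refl))) (inj₂ (inj₂ (_ , refl))) = inj₂ (inj₂ (refl , refl , refl))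
  edge-rotation _ _ (inj₂ (inj₂ (refl , refl))) (inj₁ (_ , refl)) = inj₂ (inj₁ (refl , refl , refl))
  edge-rotation _ (x≢y , _ , _) (inj₂ (inj₂ (refl , refl))) (inj₂ (inj₁ (x≡y , _))) = ⊥-elim (x≢y x≡y)
  edge-rotation _ (_ , _ , z≢x) (inj₂ (inj₂ (refl , refl))) (inj₂ (inj₂ (x≡z , _))) = ⊥-elim (z≢x (sym x≡z))

module CyclicDistance (n : ℕ) where
  v : ℕ
  v = suc n

  cdist-≤ : ∀ r y → r ≤ y → cdist v r y ≡ y ∸ r
  cdist-≤ r y r≤y with r ≤ᵇ y | ≤⇒≤ᵇ r≤y
  ... | true | _ = refl

  cdist-> : ∀ r y → y < r → cdist v r y ≡ v + y ∸ r
  cdist-> r y y<r with r ≤ᵇ y | ≤ᵇ⇒≤ r y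
  ... | true  | r≤y = ⊥-elim (<-irrefl refl (<-≤-trans y<r (r≤y tt)))
  ... | false | _   = refl

  %-add : ∀ x d → d < v → (x + d) % v ≡ (x % v + d) % v
  %-add x d d<v = trans (%-distribˡ-+ x d v) (cong (λ t → (x % v + t) % v) (m<n⇒m%n≡m d<v))

  cdist-self : ∀ r → cdist v r r ≡ 0
  cdist-self r = trans (cdist-≤ r r ≤-refl) (n∸n≡0 r)

  cdist-step : ∀ x d → d < v → cdist v (x % v) ((x + d) % v) ≡ d
  cdist-step x d d<v = trans (cong (cdist v (x % v)) (%-add x d d<v)) (fromResidue (x % v) (m%n<n x v))
    where
      fromResidue : ∀ r → r < v → cdist v r ((r + d) % v) ≡ d
      fromResidue r r<v with r + d <? v
      ... | yes r+d<v = trans (cong (cdist v r) (m<n⇒m%n≡m r+d<v))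
                              (trans (cdist-≤ r (r + d) (m≤m+n r d)) (m+n∸m≡n r d))
      ... | no r+d≮v = trans (cong (cdist v r) wrapped)
                             (trans (cdist-> r w w<r) (trans (cong (_∸ r) (trans (+-comm v w) w+v≡r+d)) (m+n∸m≡n r d)))
        where
          w : ℕ
          w = r + d ∸ v
          w+v≡r+d : w + v ≡ r + d
          w+v≡r+d = m∸n+n≡m (≮⇒≥ r+d≮v)
          w<v : w < v
          w<v = +-cancelʳ-< v w v (subst (_< v + v) (sym w+v≡r+d) (+-mono-< r<v d<v))
          w<r : w < r
          w<r = +-cancelʳ-< v w r (subst (_< r + v) (sym w+v≡r+d) (+-monoʳ-< r d<v))
          wrapped : (r + d) % v ≡ w
          wrapped = trans (cong (_% v) (sym w+v≡r+d)) (trans ([m+n]%n≡m%n w v) (m<n⇒m%n≡m w<v))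

  cdist-< : ∀ r y → r < v → y < v → cdist v r y < v
  cdist-< r y r<v y<v with r ≤? y
  ... | yes r≤y = subst (_< v) (sym (cdist-≤ r y r≤y)) (≤-<-trans (m∸n≤m y r) y<v)
  ... | no r≰y = subst (_< v) (sym (cdist-> r y (≰⇒> r≰y)))
                   (+-cancelʳ-< r _ v (subst (_< v + r) (sym (m∸n+n≡m (≤-trans (<⇒≤ r<v) (m≤m+n v y))))
                     (+-monoʳ-< v (≰⇒> r≰y))))

  cdist-back : ∀ x y → y < v → (x + cdist v (x % v) y) % v ≡ y
  cdist-back x y y<v = trans (%-add x _ (cdist-< (x % v) y (m%n<n x v) y<v)) (fromResidue (x % v) (m%n<n x v))
    where
      fromResidue : ∀ r → r < v → (r + cdist v r y) % v ≡ y
      fromResidue r r<v with r ≤? y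
      ... | yes r≤y = trans (cong (λ t → (r + t) % v) (cdist-≤ r y r≤y))
                            (trans (cong (_% v) (m+[n∸m]≡n r≤y)) (m<n⇒m%n≡m y<v))
      ... | no r≰y = trans (cong (λ t → (r + t) % v) (cdist-> r y (≰⇒> r≰y)))
                           (trans (cong (_% v) (m+[n∸m]≡n (≤-trans (<⇒≤ r<v) (m≤m+n v y))))
                             (trans (cong (_% v) (+-comm v y)) (trans ([m+n]%n≡m%n y v) (m<n⇒m%n≡m y<v))))

  Steps : ℕ → ℕ → ℕ → Set
  Steps r k y = k + r ≡ y ⊎ (y < r × k + r ≡ y + v)

  steps : ∀ x k → k < v → Steps (x % v) k ((x + k) % v)
  steps x k k<v = subst (λ d → Steps (x % v) d ((x + k) % v)) (cdist-step x k k<v) (cases (x % v) ((x + k) % v) (m%n<n x v))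
    where
      cases : ∀ r y → r < v → Steps r (cdist v r y) y
      cases r y r<v with r ≤? y
      ... | yes r≤y = inj₁ (trans (cong (_+ r) (cdist-≤ r y r≤y)) (m∸n+n≡m r≤y))
      ... | no r≰y = inj₂ (≰⇒> r≰y , trans (cong (_+ r) (cdist-> r y (≰⇒> r≰y)))
                       (trans (m∸n+n≡m (≤-trans (<⇒≤ r<v) (m≤m+n v y))) (+-comm v y)))

  cyclicOrder : ∀ {r p q a b} → q < v → 0 < a → a < b → Steps r a p → Steps r b q →
    (r < p × p < q) ⊎ (p < q × q < r) ⊎ (q < r × r < p)
  cyclicOrder {r} {a = a} _ 0<a a<b (inj₁ refl) (inj₁ refl) =
    inj₁ (subst (r <_) (+-comm r a) (m<m+n r 0<a) , +-monoˡ-< r a<b)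
  cyclicOrder {r} {a = a} _ 0<a a<b (inj₁ refl) (inj₂ (q<r , _)) =
    inj₂ (inj₂ (q<r , subst (r <_) (+-comm r a) (m<m+n r 0<a)))
  cyclicOrder {r} {p} {q} {a} {b} q<v 0<a a<b (inj₂ (_ , a+r≡p+v)) (inj₁ refl) =
    ⊥-elim (<-irrefl refl (<-≤-trans q<v (begin
      v          ≤⟨ m≤n+m v p ⟩
      p + v      ≡⟨ sym a+r≡p+v ⟩
      a + r      ≤⟨ <⇒≤ (+-monoˡ-< r a<b) ⟩
      b + r      ∎)))
    where open ≤-Reasoning
  cyclicOrder {r} q<v 0<a a<b (inj₂ (_ , a+r≡p+v)) (inj₂ (q<r , b+r≡q+v)) =
    inj₂ (inj₁ (+-cancelʳ-< _ _ _ (subst₂ _<_ a+r≡p+v b+r≡q+v (+-monoˡ-< r a<b)) , q<r))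

module Bridge (n ℓ : ℕ) (0<ℓ : 0 < ℓ) (T : List (Triple (suc n))) (mts : IsMTS (suc n) T)
              (D : Sequencing (suc n)) (good : Good ℓ T D) where
  open CyclicDistance n

  B : ℕ
  B = v ∸ ℓ

  P : ℕ → Fin v
  P x = D ⟨$⟩ˡ fromℕ< (m%n<n x v)

  pos-P : ∀ x → pos D (P x) ≡ x % v
  pos-P x = trans (cong toℕ (inverseʳ D)) (toℕ-fromℕ< _)

  P-pos : ∀ x c → x % v ≡ pos D c → P x ≡ c
  P-pos x c x≡c = trans (cong (D ⟨$⟩ˡ_) (toℕ-injective (trans (toℕ-fromℕ< _) x≡c))) (inverseˡ D)

  P-period : ∀ x → P (x + v) ≡ P x
  P-period x = P-pos (x + v) (P x) (trans ([m+n]%n≡m%n x v) (sym (pos-P x)))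

  P-injective : ∀ x d → 0 < d → d < v → P x ≡ P (x + d) → ⊥
  P-injective x d 0<d d<v same = <-irrefl (begin
    0                              ≡⟨ sym (cdist-self (x % v)) ⟩
    cdist v (x % v) (x % v)        ≡⟨ cong (cdist v (x % v)) (trans (sym (pos-P x)) (trans (cong (pos D) same) (pos-P (x + d)))) ⟩
    cdist v (x % v) ((x + d) % v)  ≡⟨ cdist-step x d d<v ⟩
    d                              ∎) 0<d
    where open ≡-Reasoning

  P-shift : ∀ x a c → a ≤ c → P (x + a + (c ∸ a)) ≡ P (x + c)
  P-shift x a c a≤c = cong P (trans (+-assoc x a (c ∸ a)) (cong (x +_) (m+[n∸m]≡n a≤c)))

  Block : Set
  Block = Fin (length T)

  E : Block → Fin v → Fin v → Set
  E j = HasEdge (lookup T j)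

  edge-cong : ∀ {j a b c d} → a ≡ c → b ≡ d → E j a b → E j c d
  edge-cong refl refl h = h

  distinctEntries : ∀ j → Distinct (lookup T j)
  distinctEntries = proj₁ mts

  unique : ∀ {j k a b} → E j a b → E k a b → j ≡ k
  unique {j} {k} {a} {b} h₁ h₂ with proj₂ mts a b (edge-distinct (lookup T j) (distinctEntries j) h₁)
  ... | _ , _ , only = trans (only j h₁) (sym (only k h₂))

  cover : ∀ x d → 0 < d → d < v → Σ Block λ j → E j (P x) (P (x + d))
  cover x d 0<d d<v with proj₂ mts (P x) (P (x + d)) (P-injective x d 0<d d<v)
  ... | j , h , _ = j , h

  third : ∀ {j} x d → 0 < d → d < v → E j (P x) (P (x + d)) →
    Σ ℕ λ e → 0 < e × e < v × (e ≡ d → ⊥) × E j (P (x + d)) (P (x + e)) × E j (P (x + e)) (P x)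
  third {j} x d _ _ h with edge-third (lookup T j) (distinctEntries j) h
  ... | c , h₁ , h₂ , c≢Px , c≢Pxd =
    e , n≢0⇒n>0 (λ e≡0 → c≢Px (trans (sym Pxe≡c) (cong P (trans (cong (x +_) e≡0) (+-identityʳ x))))) ,
    cdist-< (x % v) (pos D c) (m%n<n x v) (toℕ<n _) ,
    (λ e≡d → c≢Pxd (trans (sym Pxe≡c) (cong (λ t → P (x + t)) e≡d))) ,
    subst (E j (P (x + d))) (sym Pxe≡c) h₁ , subst (λ t → E j t (P x)) (sym Pxe≡c) h₂
    where
      e : ℕ
      e = cdist v (x % v) (pos D c)
      Pxe≡c : P (x + e) ≡ c
      Pxe≡c = P-pos (x + e) c (cdist-back x (pos D c) (toℕ<n _))

  InC-rotate : ∀ {a b c} → InC D a b c → InC D b c a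
  InC-rotate (inj₁ o) = inj₂ (inj₂ o)
  InC-rotate (inj₂ (inj₁ o)) = inj₁ o
  InC-rotate (inj₂ (inj₂ o)) = inj₂ (inj₁ o)

  InWindow-rotate : ∀ {a b c} → InWindow ℓ D a b c → InWindow ℓ D b c a
  InWindow-rotate (s , in₁ , in₂ , in₃) = s , in₂ , in₃ , in₁

  notContained : ∀ j {a b c} → E j a b → E j b c → InC D a b c → InWindow ℓ D a b c → ⊥
  notContained j h₁ h₂ inC inW with edge-rotation (lookup T j) (distinctEntries j) h₁ h₂
  ... | inj₁ (refl , refl , refl)        = good j inC inW
  ... | inj₂ (inj₁ (refl , refl , refl)) = good j (InC-rotate inC) (InWindow-rotate inW)
  ... | inj₂ (inj₂ (refl , refl , refl)) = good j (InC-rotate (InC-rotate inC)) (InWindow-rotate (InWindow-rotate inW))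

  InC-positions : ∀ {a b c p q r} → pos D a ≡ p → pos D b ≡ q → pos D c ≡ r →
    (p < q × q < r) ⊎ (q < r × r < p) ⊎ (r < p × p < q) → InC D a b c
  InC-positions refl refl refl o = o

  inOrder : ∀ x {a b} → 0 < a → a < b → b < v → InC D (P x) (P (x + a)) (P (x + b))
  inOrder x {a} {b} 0<a a<b b<v = InC-positions (pos-P x) (pos-P (x + a)) (pos-P (x + b))
    (cyclicOrder (m%n<n (x + b) v) 0<a a<b (steps x a (<-trans a<b b<v)) (steps x b b<v))

  window : ∀ x {a b} → a < v → b < v → a < ℓ → b < ℓ → InWindow ℓ D (P x) (P (x + a)) (P (x + b))
  window x {a} {b} a<v b<v a<ℓ b<ℓ =
    start , subst (_< ℓ) (sym at-start) 0<ℓ , subst (_< ℓ) (sym (offset a a<v)) a<ℓ ,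
            subst (_< ℓ) (sym (offset b b<v)) b<ℓ
    where
      start : Fin v
      start = fromℕ< (m%n<n x v)
      at-start : cdist v (toℕ start) (pos D (P x)) ≡ 0
      at-start = trans (cong₂ (cdist v) (toℕ-fromℕ< (m%n<n x v)) (pos-P x)) (cdist-self (x % v))
      offset : ∀ k → k < v → cdist v (toℕ start) (pos D (P (x + k))) ≡ k
      offset k k<v = trans (cong₂ (cdist v) (toℕ-fromℕ< (m%n<n x v)) (pos-P (x + k))) (cdist-step x k k<v)

  record Forward (j : Block) (x a b : ℕ) : Set where
    field
      0<a   : 0 < a
      a<b   : a < b
      b<v   : b < v
      edge₁ : E j (P x) (P (x + a))
      edge₂ : E j (P (x + a)) (P (x + b))
      edge₃ : E j (P (x + b)) (P x)

  -- the same triple, read from its second point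
  rotate : ∀ {j x a b} → Forward j x a b → Forward j (x + a) (b ∸ a) (v ∸ a)
  rotate {j} {x} {a} {b} f = record
    { 0<a   = m<n⇒0<n∸m a<b
    ; a<b   = ∸-monoˡ-< b<v (<⇒≤ a<b)
    ; b<v   = ∸-monoʳ-< 0<a a≤v
    ; edge₁ = edge-cong refl (sym (P-shift x a b (<⇒≤ a<b))) edge₂
    ; edge₂ = edge-cong (sym (P-shift x a b (<⇒≤ a<b))) (sym around) edge₃
    ; edge₃ = edge-cong (sym around) refl edge₁
    }
    where
      open Forward f
      a≤v : a ≤ v
      a≤v = <⇒≤ (<-trans a<b b<v)
      around : P (x + a + (v ∸ a)) ≡ P x
      around = trans (P-shift x a v a≤v) (P-period x)

  -- goodness: the last gap v - b of a forward triple is at most B, since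
  -- otherwise the window of ℓ points starting at x covers the triple
  lastGap : ∀ {j x a b} → Forward j x a b → v ∸ b ≤ B
  lastGap {j} {x} {a} {b} f = ≮⇒≥ λ B<v∸b → notContained j edge₁ edge₂ (inOrder x 0<a a<b b<v)
    (window x (<-trans a<b b<v) b<v (<-trans a<b (b<ℓ B<v∸b)) (b<ℓ B<v∸b))
    where
      open Forward f
      b<ℓ : B < v ∸ b → b < ℓ
      b<ℓ B<v∸b = +-cancelˡ-< B b ℓ (begin-strict
        B + b  <⟨ m≤o∸n⇒m+n≤o (suc B) (<⇒≤ b<v) B<v∸b ⟩
        v      ≤⟨ m≤n+m∸n v ℓ ⟩
        ℓ + B  ≡⟨ +-comm ℓ B ⟩
        B + ℓ  ∎)
        where open ≤-Reasoning

  -- all three gaps of a forward triple are at most B (read it from each of its points)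
  gapBounds : ∀ {j} x a b → 0 < a → a < b → b < v →
    E j (P x) (P (x + a)) → E j (P (x + a)) (P (x + b)) → E j (P (x + b)) (P x) →
    a ≤ B × b ≤ a + B × v ≤ b + B
  gapBounds x a b 0<a a<b b<v e₁ e₂ e₃ =
    subst (_≤ B) (m∸[m∸n]≡n a≤v) (lastGap (rotate f)) ,
    ≤-trans (m≤n+m∸n b a) (+-monoʳ-≤ a (subst (_≤ B) (m∸[m∸n]≡n b∸a≤v) (lastGap (rotate (rotate f))))) ,
    ≤-trans (m≤n+m∸n v b) (+-monoʳ-≤ b (lastGap f))
    where
      f : Forward _ x a b
      f = record { 0<a = 0<a ; a<b = a<b ; b<v = b<v ; edge₁ = e₁ ; edge₂ = e₂ ; edge₃ = e₃ }
      a≤v : a ≤ v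
      a≤v = <⇒≤ (<-trans a<b b<v)
      b∸a≤v : b ∸ a ≤ v
      b∸a≤v = ≤-trans (m∸n≤m b a) (<⇒≤ b<v)

  cyclicSystem : ∀ m → m + m ≡ v → B ≤ m → CyclicSystem m B
  cyclicSystem m 2m≡v B≤m = record
    { Point = Fin v ; P = P ; Block = Block ; E = E
    ; periodic   = λ x → trans (cong (λ t → P (x + t)) 2m≡v) (P-period x)
    ; injective  = λ x d 0<d d<2m → P-injective x d 0<d (toV d<2m)
    ; cover      = λ x d 0<d d<2m → cover x d 0<d (toV d<2m)
    ; unique     = unique
    ; out-unique = λ {j} → edge-out-unique (lookup T j) (distinctEntries j)
    ; in-unique  = λ {j} → edge-in-unique (lookup T j) (distinctEntries j)
    ; third      = λ x d 0<d d<2m h → let (e , 0<e , e<v , rest) = third x d 0<d (toV d<2m) h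
                                     in e , 0<e , subst (e <_) (sym 2m≡v) e<v , rest
    ; gaps       = λ x a b 0<a a<b b<2m e₁ e₂ e₃ → let (a≤B , b≤a+B , v≤b+B) = gapBounds x a b 0<a a<b (toV b<2m) e₁ e₂ e₃
                                                  in a≤B , b≤a+B , subst (_≤ b + B) (sym 2m≡v) v≤b+B
    ; B≤m        = B≤m
    }
    where
      toV : ∀ {d} → d < m + m → d < v
      toV {d} = subst (d <_) 2m≡v

+-double : ∀ q → q + q ≡ 2 * q
+-double q = cong (q +_) (sym (+-identityʳ q))

gapBound≤half : ∀ {v} q ℓ → q + q ≡ v → v ≤ 2 * ℓ → v ∸ ℓ ≤ q
gapBound≤half q ℓ refl 2q≤2ℓ = ≤-trans (∸-monoʳ-≤ (q + q) q≤ℓ) (≤-reflexive (m+n∸m≡n q q))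
  where
    q≤ℓ : q ≤ ℓ
    q≤ℓ = *-cancelˡ-≤ 2 (subst (_≤ 2 * ℓ) (+-double q) 2q≤2ℓ)

gapBoundSmall : ∀ {v} q ℓ .{{_ : NonZero q}} → q + q ≡ v → 3 ≤ ℓ → v ∸ ℓ < q ⊎ 3 ≤ q
gapBoundSmall q ℓ refl 3≤ℓ with 3 ≤? q
... | yes 3≤q = inj₂ 3≤q
... | no 3≰q  = inj₁ (m<n+o⇒m∸n<o (q + q) ℓ (+-monoˡ-< q (<-≤-trans (≰⇒> 3≰q) 3≤ℓ)))

mainTheorem1 : (v : ℕ) → 2 ∣ v → 0 < v → (ℓ : ℕ) → 3 ≤ ℓ → v ≤ 2 * ℓ →
    (T : List (Triple v)) → IsMTS v T → (D : Sequencing v) → ¬ Good ℓ T D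
mainTheorem1 (suc n) (divides zero ())
mainTheorem1 (suc n) (divides (suc q) v≡q*2) _ ℓ 3≤ℓ v≤2ℓ T mts D good =
  noCyclicSystem (gapBoundSmall (suc q) ℓ 2q≡v 3≤ℓ)
    (Bridge.cyclicSystem n ℓ 0<ℓ T mts D good (suc q) 2q≡v (gapBound≤half (suc q) ℓ 2q≡v v≤2ℓ))
  where
    0<ℓ : 0 < ℓ
    0<ℓ = <-trans (s≤s z≤n) 3≤ℓ
    2q≡v : suc q + suc q ≡ suc n
    2q≡v = trans (+-double (suc q)) (trans (*-comm 2 (suc q)) (sym v≡q*2))
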